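{- Let $B$ be a set of time-constructible bounds with $\mathcal{B}_{\mathrm{lin}}\le_a B$ such that $B\cup\{\beta_{\mathrm{id}}\}$ is tame. Then $B$ is regular if and only if $\mathrm{It}(B)\le_a B$.
   Context: A (time) bound is $\beta:\mathbb{N}\to\mathbb{N}$ with $n\le\beta(n)\le\beta(n+1)$; $\beta_{\mathrm{id}}(n)=n$. $f\le_a g$: $f(n)\le g(n)$ for almost all $n$; for sets, $B_1\le_a B_2$: each element of $B_1$ is $\le_a$ some element of $B_2$. $\mathcal{B}_{\mathrm{lin}}=\{cn:c\in\mathbb{N}^+\}$. $\mathrm{It}(\beta)=\{\beta^{\langle m\rangle}:m\ge1\}$ ($m$-fold iterates), $\mathrm{It}(B)=\bigcup_{\beta\in B}\mathrm{It}(\beta)$. Time-constructible: $w\mapsto1^{\beta(|w|)}$ computable by a deterministic multitape TM with output tape in time $O(\beta(|w|))$. A nonempty set $B$ is regular if (i) every $\beta\in B$ has a time-constructible $\beta'\in B$ with $\beta\le_a\beta'$, and (ii) for all $\beta,\beta'\in B$ some $\beta''\in B$ satisfies $\beta+\beta'\circ\beta\le_a\beta''$. A set $U$ of bounds is tame if for all $\beta_1,\beta_2\in U$, $\lim_{n\to\infty,n>0}\beta_1(n)/\beta_2(n)$ exists in $\mathbb{R}\cup\{\infty\}$. -}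

module Defs where

open import Data.Nat using (ℕ; zero; suc; _+_; _*_; _≤_; _<_)
open import Data.Integer as ℤ using (ℤ; +_)
open import Data.Integer.Properties using () renaming (_≟_ to _≟ℤ_)
open import Data.Rational.Unnormalised as Q using (ℚᵘ; 0ℚᵘ)
open import Data.Fin using (Fin; zero; suc)
open import Data.Bool using (Bool; true; false; if_then_else_)
open import Data.List using (List; []; _∷_; length)
open import Data.Product using (Σ; ∃; ∃-syntax; _×_; _,_; proj₁; proj₂)
open import Data.Sum using (_⊎_)
open import Relation.Nullary using (does)
open import Relation.Binary.PropositionalEquality using (_≡_)

-- Tape alphabet Fin (3 + g): symbol 0 is the blank, symbols 1 and 2
-- encode the input bits false / true; symbol 1 is also the output
-- symbol '1'.  Tapes are indexed by Fin (2 + k): tape 0 is the input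
-- tape, tape 1 is the output tape, the remaining k are work tapes.

data Move : Set where
  left stay right : Move

record TM : Set where
  field
    k      : ℕ
    g      : ℕ
    nQ     : ℕ
    start  : Fin nQ
    halting : Fin nQ → Bool
    δ      : Fin nQ → (Fin (2 + k) → Fin (3 + g)) →
             Fin nQ × (Fin (2 + k) → Fin (3 + g)) × (Fin (2 + k) → Move)

record Config (M : TM) : Set where
  field
    state : Fin (TM.nQ M)
    tape  : Fin (2 + TM.k M) → ℤ → Fin (3 + TM.g M)
    head  : Fin (2 + TM.k M) → ℤ

blank : ∀ {g} → Fin (3 + g)
blank = zero

one : ∀ {g} → Fin (3 + g)
one = suc zero

bitSym : ∀ {g} → Bool → Fin (3 + g)
bitSym false = suc zero
bitSym true  = suc (suc zero)

inputTape : ∀ {g} → List Bool → ℤ → Fin (3 + g)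
inputTape []      i = blank
inputTape (b ∷ w) (+ zero)   = bitSym b
inputTape (b ∷ w) (+ suc n)  = inputTape w (+ n)
inputTape (b ∷ w) ℤ.-[1+ n ] = blank

initial : (M : TM) → List Bool → Config M
initial M w = record
  { state = TM.start M
  ; tape  = λ { zero → inputTape w ; (suc _) → λ _ → blank }
  ; head  = λ _ → + 0
  }

moveHead : Move → ℤ → ℤ
moveHead left  i = i ℤ.- + 1
moveHead stay  i = i
moveHead right i = i ℤ.+ + 1

step : (M : TM) → Config M → Config M
step M c with TM.halting M (Config.state c)
... | true  = c
... | false =
  let read = λ t → Config.tape c t (Config.head c t)
      r    = TM.δ M (Config.state c) read
      q'   = proj₁ r
      wr   = proj₁ (proj₂ r)
      mv   = proj₂ (proj₂ r)
  in record
    { state = q'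
    ; tape  = λ t i → if does (i ≟ℤ Config.head c t) then wr t
                      else Config.tape c t i
    ; head  = λ t → moveHead (mv t) (Config.head c t)
    }

run : (M : TM) → ℕ → Config M → Config M
run M zero    c = c
run M (suc t) c = run M t (step M c)

unaryAt : ∀ {g} → ℕ → ℤ → Fin (3 + g)
unaryAt m (+ i)      = if does (Data.Nat._<?_ i m) then one else blank
unaryAt m ℤ.-[1+ _ ] = blank

OutputsUnary : (M : TM) → Config M → ℕ → Set
OutputsUnary M c m =
  (TM.halting M (Config.state c) ≡ true) ×
  (∀ i → Config.tape c (suc zero) i ≡ unaryAt m i)

-- β is time-constructible: some machine maps w to 1^β(|w|) in time O(β(|w|))
-- (we take "time O(β(|w|))" as: at most c·(β(|w|)+1) steps, for a constant c)
TimeConstructible : (ℕ → ℕ) → Set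
TimeConstructible β =
  Σ TM λ M → Σ ℕ λ c → ∀ (w : List Bool) →
    OutputsUnary M (run M (c * suc (β (length w))) (initial M w)) (β (length w))

IsBound : (ℕ → ℕ) → Set
IsBound β = (∀ n → n ≤ β n) × (∀ n → β n ≤ β (suc n))

βid : ℕ → ℕ
βid n = n

SetOfBounds : Set₁
SetOfBounds = (ℕ → ℕ) → Set

_≤ₐ_ : (ℕ → ℕ) → (ℕ → ℕ) → Set
f ≤ₐ g = ∃[ N ] (∀ n → N ≤ n → f n ≤ g n)

_≤ₐˢ_ : SetOfBounds → SetOfBounds → Set
B₁ ≤ₐˢ B₂ = ∀ f → B₁ f → ∃[ g ] (B₂ g × f ≤ₐ g)

Blin : SetOfBounds
Blin f = ∃[ c ] (1 ≤ c × (∀ n → f n ≡ c * n))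

iter : ℕ → (ℕ → ℕ) → ℕ → ℕ
iter zero    β n = n
iter (suc m) β n = β (iter m β n)

It : SetOfBounds → SetOfBounds
It B f = ∃[ β ] ∃[ m ] (B β × 1 ≤ m × (∀ n → f n ≡ iter m β n))

_∪｛βid｝ : SetOfBounds → SetOfBounds
(B ∪｛βid｝) f = B f ⊎ (∀ n → f n ≡ n)

Regular : SetOfBounds → Set
Regular B =
  (∃[ β ] B β) ×
  (∀ β → B β → ∃[ β′ ] (B β′ × TimeConstructible β′ × β ≤ₐ β′)) ×
  (∀ β β′ → B β → B β′ →
     ∃[ β″ ] (B β″ × (λ n → β n + β′ (β n)) ≤ₐ β″))

-- Tameness.  The ratio a/b as an (unnormalised) rational; the b = 0 case
-- is a junk value never used (for bounds, β(n) ≥ n ≥ 1 when n > 0).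

frac : ℕ → ℕ → ℚᵘ
frac a zero    = 0ℚᵘ
frac a (suc b) = (+ a) Q./ suc b

-- the sequence β₁(n)/β₂(n), n > 0 (reindexed: n ↦ n+1)
ratio : (ℕ → ℕ) → (ℕ → ℕ) → ℕ → ℚᵘ
ratio β₁ β₂ n = frac (β₁ (suc n)) (β₂ (suc n))

-- a rational sequence converges to a real limit  ⇔  it is Cauchy
ConvergesInℝ : (ℕ → ℚᵘ) → Set
ConvergesInℝ s = ∀ (ε : ℚᵘ) → 0ℚᵘ Q.< ε →
  ∃[ N ] (∀ m n → N ≤ m → N ≤ n → Q.∣ s m Q.- s n ∣ Q.< ε)

DivergesToInfinity : (ℕ → ℚᵘ) → Set
DivergesToInfinity s = ∀ (M : ℕ) → ∃[ N ] (∀ n → N ≤ n → (+ M) Q./ 1 Q.≤ s n)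

LimitExists : (ℕ → ℕ) → (ℕ → ℕ) → Set
LimitExists β₁ β₂ = ConvergesInℝ (ratio β₁ β₂) ⊎ DivergesToInfinity (ratio β₁ β₂)

Tame : SetOfBounds → Set
Tame U = ∀ β₁ β₂ → U β₁ → U β₂ → LimitExists β₁ β₂

-- Tameness of B ∪ {βid} makes every β ∈ B either O(n) or eventually above
-- every K·n.  If B is closed under iterates, this gives closure under constant
-- multiples up to ≤ₐ: an O(n) bound is absorbed by B_lin, and otherwise
-- K·β ≤ₐ β ∘ β.  Tameness of pairs likewise yields common upper bounds γ ∈ B,
-- and then β + β′ ∘ β ≤ₐ 2·(γ ∘ γ).  Conversely, if B is regular and g ∈ B lies
-- above the m-th iterate of β, the next iterate lies below β ∘ g ≤ g + β ∘ g.
module Submission where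

open import Defs
open import Data.Nat using (ℕ; zero; suc; _+_; _*_; _≤_; _≥_; _≤′_; ≤′-refl; ≤′-step; _⊔_; z≤n; s≤s)
open import Data.Nat.Properties
open import Data.Integer as ℤ using (+_; -[1+_])
import Data.Integer.Properties as ℤP
open import Data.Rational.Unnormalised as Q using (ℚᵘ; mkℚᵘ; 1ℚᵘ; *≤*; *<*; ↥_)
import Data.Rational.Unnormalised.Properties as QP
open import Data.Product using (_×_; _,_; proj₁; proj₂; ∃-syntax)
open import Data.Sum using (inj₁; inj₂)
open import Function using (_∘_)
open import Function.Bundles using (_⇔_; mk⇔)
open import Relation.Binary.Core using (_Preserves_⟶_)
open import Relation.Binary.PropositionalEquality using (refl; sym; cong)

private
  variable
    f g h β β′ β₁ β₂ : ℕ → ℕ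

Inflationary : (ℕ → ℕ) → Set
Inflationary f = ∀ n → f n ≥ n

bound-inflationary : IsBound β → Inflationary β
bound-inflationary = proj₁

bound-monotone : IsBound β → β Preserves _≤_ ⟶ _≤_
bound-monotone {β} (_ , step) m≤n = go (≤⇒≤′ m≤n)
  where
  go : ∀ {m n} → m ≤′ n → β m ≤ β n
  go ≤′-refl       = ≤-refl
  go (≤′-step m≤n) = ≤-trans (go m≤n) (step _)

≤⇒≤ₐ : (∀ n → f n ≤ g n) → f ≤ₐ g
≤⇒≤ₐ f≤g = 0 , λ n _ → f≤g n

≤ₐ-refl : f ≤ₐ f
≤ₐ-refl = ≤⇒≤ₐ (λ _ → ≤-refl)

≤ₐ-trans : f ≤ₐ g → g ≤ₐ h → f ≤ₐ h
≤ₐ-trans (M , f≤g) (N , g≤h) =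
  M ⊔ N , λ n p → ≤-trans (f≤g n (m⊔n≤o⇒m≤o M N p)) (g≤h n (m⊔n≤o⇒n≤o M N p))

≤ₐ-+ : ∀ {f₁ f₂ g₁ g₂ : ℕ → ℕ} → f₁ ≤ₐ g₁ → f₂ ≤ₐ g₂ →
       (λ n → f₁ n + f₂ n) ≤ₐ (λ n → g₁ n + g₂ n)
≤ₐ-+ (M , f₁≤g₁) (N , f₂≤g₂) =
  M ⊔ N , λ n p → +-mono-≤ (f₁≤g₁ n (m⊔n≤o⇒m≤o M N p)) (f₂≤g₂ n (m⊔n≤o⇒n≤o M N p))

≤ₐ-*ˡ : ∀ K → f ≤ₐ g → (λ n → K * f n) ≤ₐ (λ n → K * g n)
≤ₐ-*ˡ K (N , f≤g) = N , λ n p → *-monoʳ-≤ K (f≤g n p)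

≤ₐ-∘ˡ : h Preserves _≤_ ⟶ _≤_ → f ≤ₐ g → (h ∘ f) ≤ₐ (h ∘ g)
≤ₐ-∘ˡ h-mono (N , f≤g) = N , λ n p → h-mono (f≤g n p)

≤ₐ-∘ʳ : Inflationary h → f ≤ₐ g → (f ∘ h) ≤ₐ (g ∘ h)
≤ₐ-∘ʳ h-infl (N , f≤g) = N , λ n p → f≤g _ (≤-trans p (h-infl n))

≤ₐ-shift : ∀ N → (∀ n → N ≤ n → f (suc n) ≤ g (suc n)) → f ≤ₐ g
≤ₐ-shift N f≤g = suc N , λ { (suc n) (s≤s p) → f≤g n p }

≤ₐ-multiple⇒≤ₐ-suc-multiple : ∀ C → f ≤ₐ (λ n → C * g n) → f ≤ₐ (λ n → suc C * g n)
≤ₐ-multiple⇒≤ₐ-suc-multiple {g = g} C f≤Cg =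
  ≤ₐ-trans f≤Cg (≤⇒≤ₐ λ n → m≤n+m (C * g n) (g n))

infix 4 _≤ₐ∈_

_≤ₐ∈_ : (ℕ → ℕ) → SetOfBounds → Set
f ≤ₐ∈ B = ∃[ g ] (B g × f ≤ₐ g)

≤ₐ∈-resp : ∀ {B} → f ≤ₐ g → g ≤ₐ∈ B → f ≤ₐ∈ B
≤ₐ∈-resp f≤g (h , Bh , g≤h) = h , Bh , ≤ₐ-trans f≤g g≤h

i≤+∣i∣ : ∀ i → i ℤ.≤ + ℤ.∣ i ∣
i≤+∣i∣ (+ n)    = ℤP.≤-refl
i≤+∣i∣ -[1+ n ] = ℤ.-≤+

p≤∣p∣ : ∀ p → p Q.≤ Q.∣ p ∣
p≤∣p∣ (mkℚᵘ i d) = *≤* (ℤP.*-monoʳ-≤-nonNeg (+ suc d) (i≤+∣i∣ i))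

p≃p-q+q : ∀ p q → p Q.≃ (p Q.- q) Q.+ q
p≃p-q+q p q = QP.≃-sym (begin-equality
  (p Q.- q) Q.+ q      ≃⟨ QP.+-assoc p (Q.- q) q ⟩
  p Q.+ (Q.- q Q.+ q)  ≃⟨ QP.+-congʳ p (QP.+-inverseˡ q) ⟩
  p Q.+ Q.0ℚᵘ          ≃⟨ QP.+-identityʳ p ⟩
  p                    ∎)
  where open QP.≤-Reasoning

cauchy⇒eventually-bounded : ∀ (s : ℕ → ℚᵘ) → ConvergesInℝ s →
                            ∃[ q ] ∃[ N ] (∀ n → N ≤ n → s n Q.≤ q)
cauchy⇒eventually-bounded s cauchy with cauchy 1ℚᵘ (*<* (ℤ.+<+ (s≤s z≤n)))
... | N , close = 1ℚᵘ Q.+ s N , N , λ n N≤n → begin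
  s n                        ≃⟨ p≃p-q+q (s n) (s N) ⟩
  (s n Q.- s N) Q.+ s N      ≤⟨ QP.+-monoˡ-≤ (s N) (p≤∣p∣ (s n Q.- s N)) ⟩
  Q.∣ s n Q.- s N ∣ Q.+ s N  ≤⟨ QP.+-monoˡ-≤ (s N) (QP.<⇒≤ (close n N N≤n ≤-refl)) ⟩
  1ℚᵘ Q.+ s N                ∎
  where open QP.≤-Reasoning

frac≤⇒≤ : ∀ a b q → 1 ≤ b → frac a b Q.≤ q → a ≤ ℤ.∣ ↥ q ∣ * b
frac≤⇒≤ a (suc b) (mkℚᵘ i d) _ (*≤* a*d≤i*b) =
  ≤-trans (m≤m*n a (suc d)) (ℤP.drop‿+≤+ (begin
    + (a * suc d)          ≡⟨ ℤP.pos-* a (suc d) ⟩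
    + a ℤ.* + suc d        ≤⟨ a*d≤i*b ⟩
    i ℤ.* + suc b          ≤⟨ ℤP.*-monoʳ-≤-nonNeg (+ suc b) (i≤+∣i∣ i) ⟩
    + ℤ.∣ i ∣ ℤ.* + suc b  ≡⟨ ℤP.pos-* ℤ.∣ i ∣ (suc b) ⟨
    + (ℤ.∣ i ∣ * suc b)    ∎))
  where open ℤP.≤-Reasoning

≤frac⇒*≤ : ∀ M a b → 1 ≤ b → (+ M) Q./ 1 Q.≤ frac a b → M * b ≤ a
≤frac⇒*≤ M a (suc b) _ (*≤* M*b≤a) = ℤP.drop‿+≤+ (begin
  + (M * suc b)    ≡⟨ ℤP.pos-* M (suc b) ⟩
  + M ℤ.* + suc b  ≤⟨ M*b≤a ⟩
  + a ℤ.* + 1      ≡⟨ ℤP.*-identityʳ (+ a) ⟩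
  + a              ∎)
  where open ℤP.≤-Reasoning

convergent-ratio⇒≤ₐ-multiple : Inflationary β₂ → ConvergesInℝ (ratio β₁ β₂) →
                               ∃[ C ] β₁ ≤ₐ (λ n → C * β₂ n)
convergent-ratio⇒≤ₐ-multiple {β₂} {β₁} infl conv
  with cauchy⇒eventually-bounded (ratio β₁ β₂) conv
... | q , N , ratio≤q = ℤ.∣ ↥ q ∣ , ≤ₐ-shift N λ n N≤n →
  frac≤⇒≤ (β₁ (suc n)) (β₂ (suc n)) q (≤-trans (s≤s z≤n) (infl (suc n))) (ratio≤q n N≤n)

divergent-ratio⇒multiples-≤ₐ : Inflationary β₂ → DivergesToInfinity (ratio β₁ β₂) →
                               ∀ M → (λ n → M * β₂ n) ≤ₐ β₁
divergent-ratio⇒multiples-≤ₐ {β₂} {β₁} infl div M with div M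
... | N , M≤ratio = ≤ₐ-shift N λ n N≤n →
  ≤frac⇒*≤ M (β₁ (suc n)) (β₂ (suc n)) (≤-trans (s≤s z≤n) (infl (suc n))) (M≤ratio n N≤n)

module _ (B : SetOfBounds) (monotone : ∀ {β} → B β → β Preserves _≤_ ⟶ _≤_) where

  iterate-≤ₐ∈ : Regular B → B β → ∀ m → iter (suc m) β ≤ₐ∈ B
  iterate-≤ₐ∈ reg Bβ zero = _ , Bβ , ≤ₐ-refl
  iterate-≤ₐ∈ {β} reg Bβ (suc m) with iterate-≤ₐ∈ reg Bβ m
  ... | g , Bg , iter≤g = ≤ₐ∈-resp
    (≤ₐ-trans (≤ₐ-∘ˡ (monotone Bβ) iter≤g) (≤⇒≤ₐ λ n → m≤n+m (β (g n)) (g n)))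
    (proj₂ (proj₂ reg) g β Bg Bβ)

  regular⇒It≤ₐB : Regular B → It B ≤ₐˢ B
  regular⇒It≤ₐB reg f (β , suc m , Bβ , _ , f≗iter) =
    ≤ₐ∈-resp (≤⇒≤ₐ (≤-reflexive ∘ f≗iter)) (iterate-≤ₐ∈ reg Bβ m)

module _ (B : SetOfBounds)
         (bounds : ∀ {β} → B β → IsBound β)
         (lin : Blin ≤ₐˢ B)
         (tame : Tame (B ∪｛βid｝))
         (closed : It B ≤ₐˢ B) where

  ∘-self-≤ₐ∈ : B β → β ∘ β ≤ₐ∈ B
  ∘-self-≤ₐ∈ {β} Bβ = closed (β ∘ β) (β , 2 , Bβ , s≤s z≤n , λ _ → refl)

  linear-≤ₐ∈ : ∀ c → (λ n → suc c * n) ≤ₐ∈ B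
  linear-≤ₐ∈ c = lin _ (suc c , s≤s z≤n , λ _ → refl)

  multiple-of-linear-≤ₐ∈ : ∀ K C → β ≤ₐ (λ n → C * n) → (λ n → K * β n) ≤ₐ∈ B
  multiple-of-linear-≤ₐ∈ {β} K C β≤Cn = ≤ₐ∈-resp
    (≤ₐ-multiple⇒≤ₐ-suc-multiple (K * C)
      (≤ₐ-trans {g = λ n → K * (C * n)} (≤ₐ-*ˡ K β≤Cn)
                (≤⇒≤ₐ λ n → ≤-reflexive (sym (*-assoc K C n)))))
    (linear-≤ₐ∈ (K * C))

  multiple-of-superlinear-≤ₐ∈ : ∀ K → B β → (λ n → K * n) ≤ₐ β → (λ n → K * β n) ≤ₐ∈ B
  multiple-of-superlinear-≤ₐ∈ {β} K Bβ Kn≤β =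
    ≤ₐ∈-resp (≤ₐ-∘ʳ {h = β} {g = β} (bound-inflationary (bounds Bβ)) Kn≤β) (∘-self-≤ₐ∈ Bβ)

  multiple-≤ₐ∈ : ∀ K → B β → (λ n → K * β n) ≤ₐ∈ B
  multiple-≤ₐ∈ {β} K Bβ with tame β βid (inj₁ Bβ) (inj₂ λ _ → refl)
  ... | inj₁ conv = let C , β≤Cn = convergent-ratio⇒≤ₐ-multiple {βid} {β} (λ _ → ≤-refl) conv
                    in multiple-of-linear-≤ₐ∈ K C β≤Cn
  ... | inj₂ div  = multiple-of-superlinear-≤ₐ∈ K Bβ
                      (divergent-ratio⇒multiples-≤ₐ {βid} {β} (λ _ → ≤-refl) div K)

  common-upper-bound : B β₁ → B β₂ → ∃[ γ ] (B γ × β₁ ≤ₐ γ × β₂ ≤ₐ γ)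
  common-upper-bound {β₁} {β₂} Bβ₁ Bβ₂ with tame β₁ β₂ (inj₁ Bβ₁) (inj₁ Bβ₂)
  ... | inj₁ conv =
    let C , β₁≤Cβ₂ = convergent-ratio⇒≤ₐ-multiple (bound-inflationary (bounds Bβ₂)) conv
        γ , Bγ , Cβ₂≤γ = multiple-≤ₐ∈ (suc C) Bβ₂
    in γ , Bγ , ≤ₐ-trans (≤ₐ-multiple⇒≤ₐ-suc-multiple C β₁≤Cβ₂) Cβ₂≤γ
             , ≤ₐ-trans (≤⇒≤ₐ λ n → m≤m+n (β₂ n) (C * β₂ n)) Cβ₂≤γ
  ... | inj₂ div =
    β₁ , Bβ₁ , ≤ₐ-refl
       , ≤ₐ-trans (≤⇒≤ₐ λ n → ≤-reflexive (sym (*-identityˡ (β₂ n))))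
                  (divergent-ratio⇒multiples-≤ₐ (bound-inflationary (bounds Bβ₂)) div 1)

  -- With γ above β and β′:  β + β′ ∘ β ≤ₐ γ + γ ∘ γ ≤ 2 · (γ ∘ γ).
  sum-∘-≤ₐ∈ : B β → B β′ → (λ n → β n + β′ (β n)) ≤ₐ∈ B
  sum-∘-≤ₐ∈ {β} {β′} Bβ Bβ′ with common-upper-bound Bβ Bβ′
  ... | γ , Bγ , β≤γ , β′≤γ with ∘-self-≤ₐ∈ Bγ
  ...   | γ² , Bγ² , γγ≤γ² = ≤ₐ∈-resp
    (≤ₐ-trans (≤ₐ-+ β≤γ β′∘β≤γ∘γ)
    (≤ₐ-trans (≤⇒≤ₐ γ+γ∘γ≤2·γ∘γ) (≤ₐ-*ˡ 2 γγ≤γ²)))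
    (multiple-≤ₐ∈ 2 Bγ²)
    where
    γ+γ∘γ≤2·γ∘γ : ∀ n → γ n + γ (γ n) ≤ 2 * γ (γ n)
    γ+γ∘γ≤2·γ∘γ n = ≤-trans (+-monoˡ-≤ (γ (γ n)) (bound-inflationary (bounds Bγ) (γ n)))
                            (≤-reflexive (cong (λ k → γ (γ n) + k) (sym (+-identityʳ _))))

    β′∘β≤γ∘γ : (β′ ∘ β) ≤ₐ (γ ∘ γ)
    β′∘β≤γ∘γ = ≤ₐ-trans (≤ₐ-∘ʳ (bound-inflationary (bounds Bβ)) β′≤γ)
                        (≤ₐ-∘ˡ (bound-monotone (bounds Bγ)) β≤γ)

  It≤ₐB⇒regular : (∀ {β} → B β → TimeConstructible β) → Regular B
  It≤ₐB⇒regular constructible =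
    (let (β , Bβ , _) = linear-≤ₐ∈ 0 in β , Bβ) ,
    (λ β Bβ → β , Bβ , constructible Bβ , ≤ₐ-refl) ,
    (λ β β′ → sum-∘-≤ₐ∈)

corollary1 : (B : SetOfBounds) →
    (∀ β → B β → IsBound β × TimeConstructible β) →
    Blin ≤ₐˢ B →
    Tame (B ∪｛βid｝) →
    Regular B ⇔ (It B ≤ₐˢ B)
corollary1 B hyp lin tame = mk⇔
  (regular⇒It≤ₐB B (bound-monotone ∘ bounds))
  (λ closed → It≤ₐB⇒regular B bounds lin tame closed (proj₂ ∘ hyp _))
  where
  bounds : ∀ {β} → B β → IsBound β
  bounds = proj₁ ∘ hyp _
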